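{- Let $n,k,l\in\mathbb{N}$ and $r\in\mathbb{N}\cup\{0\}$ with $n=3^lk+r$ and $0\le r<3^l$. Then there are sequences $(\Sigma_{n,i})_{i=1}^l$ and $(T_{n,i})_{i=1}^l$ in $S_n$ such that, for $1\le i,j\le l$: if $i<j$ then $\Sigma_{n,i}$ and $T_{n,j}$ commute, while if $i\ge j$ then $[\Sigma_{n,i},T_{n,j}]$ is the product of $3^{l-1}k$ disjoint cycles of length $3$, and in particular $$d([\Sigma_{n,i},T_{n,j}],e)=\frac{3^lk}{3^lk+r}\ge\frac{k}{k+1}\ge\frac12.$$
   Context: $S_n$ is the symmetric group on $\{1,\dots,n\}$ with the normalized Hamming distance $d(\sigma,\tau)=\frac1n|\{i:\sigma(i)\neq\tau(i)\}|$, and $e$ is its identity. $[a,b]=aba^{ -1}b^{ -1}$. -}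

module Defs where

open import Data.Nat using (ℕ; zero; suc)
open import Data.Fin using (Fin)
open import Data.Fin.Properties using (_≟_)
open import Data.Fin.Permutation using (Permutation′; _⟨$⟩ʳ_; _⟨$⟩ˡ_)
open import Data.Integer using (+_)
open import Data.Rational.Unnormalised using (ℚᵘ; 0ℚᵘ; _/_)
open import Data.List using (List; []; _∷_; _++_; length; filter; allFin; concatMap)
open import Data.List.Relation.Unary.Unique.Propositional using (Unique)
open import Data.List.Membership.Propositional using (_∈_; _∉_)
open import Data.Product using (_×_; _,_)
open import Relation.Binary.PropositionalEquality using (_≡_)
open import Relation.Nullary using (¬_; ¬?)

-- S_n : permutations of Fin n (the paper's {1,…,n})
Perm : ℕ → Set
Perm n = Permutation′ n

Commute : ∀ {n} → Perm n → Perm n → Set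
Commute {n} σ τ = ∀ (x : Fin n) → σ ⟨$⟩ʳ (τ ⟨$⟩ʳ x) ≡ τ ⟨$⟩ʳ (σ ⟨$⟩ʳ x)

commutator : ∀ {n} → Perm n → Perm n → Fin n → Fin n
commutator a b x = a ⟨$⟩ʳ (b ⟨$⟩ʳ (a ⟨$⟩ˡ (b ⟨$⟩ˡ x)))

points : ∀ {n} → List (Fin n × Fin n × Fin n) → List (Fin n)
points = concatMap (λ { (a , b , c) → a ∷ b ∷ c ∷ [] })

IsProdOf3Cycles : ∀ {n} → (Fin n → Fin n) → List (Fin n × Fin n × Fin n) → Set
IsProdOf3Cycles {n} f cs =
  Unique (points cs)
  × (∀ {a b c} → (a , b , c) ∈ cs → (f a ≡ b) × (f b ≡ c) × (f c ≡ a))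
  × (∀ (x : Fin n) → x ∉ points cs → f x ≡ x)

IsProdOfDisjoint3Cycles : ∀ {n} → ℕ → (Fin n → Fin n) → Set
IsProdOfDisjoint3Cycles {n} m f =
  Data.Product.∃ λ (cs : List (Fin n × Fin n × Fin n)) → (length cs ≡ m) × IsProdOf3Cycles f cs

-- a / b as an (unnormalised) rational, with the convention a / 0 = 0
frac : ℕ → ℕ → ℚᵘ
frac a zero    = 0ℚᵘ
frac a (suc b) = (+ a) / suc b

hammingCount : ∀ {n} → (Fin n → Fin n) → (Fin n → Fin n) → ℕ
hammingCount {n} f g = length (filter (λ i → ¬? (f i ≟ g i)) (allFin n))

d : ∀ {n} → (Fin n → Fin n) → (Fin n → Fin n) → ℚᵘ
d {n} f g = frac (hammingCount f g) n

e : ∀ {n} → Fin n → Fin n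
e x = x

-- The first 3^l·k points are identified with
-- "words" (x, a₁, …, a_l), x ∈ Fin k, aᵢ ∈ Fin 3, by iterating the
-- bijection Fin m × Fin 3 ≅ Fin (m·3); the last r points stay fixed.
-- Σᵢ applies the 3-cycle ρ⁻¹ to the letter aᵢ, and Tⱼ applies the
-- transposition (0 1) to every letter a_j, a_{j+1}, …, a_l.  If i < j
-- they act on disjoint letters and commute.  If j ≤ i, the letters
-- other than aᵢ contribute (0 1)² = id to the commutator, and the
-- letter aᵢ contributes ρ⁻¹(0 1)ρ(0 1) = ρ, so [Σᵢ, Tⱼ] = Σᵢ⁻¹.  Since
-- ρ has no fixed point, Σᵢ⁻¹ is a product of 3^(l-1)·k disjoint
-- 3-cycles (one per choice of the other letters) moving exactly the
-- first 3^l·k points.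
module Submission where

open import Defs
open import Data.Nat using (ℕ; zero; suc; _+_; _*_; _^_; _∸_; _≤_; _<_; z≤n; s≤s)
import Data.Nat.Properties as ℕ
open import Data.Fin using (Fin; suc; toℕ; _↑ˡ_; _↑ʳ_; splitAt; combine; remQuot)
open import Data.Fin.Patterns using (0F; 1F; 2F)
import Data.Fin.Properties as Fin
open import Data.Fin.Properties using (_≟_)
open import Data.Fin.Permutation using (permutation)
open import Data.Product using (∃₂; _×_; _,_; proj₁; proj₂; swap; map₂)
open import Data.Product.Properties using (,-injectiveˡ; ,-injectiveʳ)
open import Data.Sum using (_⊎_; inj₁; inj₂; [_,_]′)
open import Data.List using (List; []; _∷_; _++_; length; map; filter; allFin; tabulate; cartesianProductWith)
import Data.List.Properties as List
open import Data.List.Membership.Propositional using (_∈_; _∉_)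
open import Data.List.Membership.Propositional.Properties using (∈-map⁻; ∈-allFin; ∈-cartesianProductWith⁺)
import Data.List.Relation.Unary.All.Properties as All
open import Data.List.Relation.Unary.Unique.Propositional using (Unique)
import Data.List.Relation.Unary.Unique.Propositional.Properties as Unique
import Data.Integer as ℤ
open import Data.Integer.Properties using (pos-*)
open import Data.Rational.Unnormalised using (_≃_; *≤*) renaming (_≤_ to _≤ᵘ_)
open import Data.Rational.Unnormalised.Properties using (≃-reflexive)
open import Relation.Binary.PropositionalEquality
  using (_≡_; _≢_; refl; sym; trans; cong; cong₂; subst; subst₂; _≗_; module ≡-Reasoning)
open import Relation.Nullary using (Dec; ¬?)
open import Data.Empty using (⊥-elim)
open import Function using (_∘_; _$_; id; flip)

End : ℕ → Set
End m = Fin m → Fin m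

ρ ρ⁻¹ swap01 : End 3
ρ 0F = 1F
ρ 1F = 2F
ρ 2F = 0F
ρ⁻¹ 0F = 2F
ρ⁻¹ 1F = 0F
ρ⁻¹ 2F = 1F
swap01 0F = 1F
swap01 1F = 0F
swap01 2F = 2F

ρ-ρ⁻¹ : ∀ a → ρ (ρ⁻¹ a) ≡ a
ρ-ρ⁻¹ 0F = refl
ρ-ρ⁻¹ 1F = refl
ρ-ρ⁻¹ 2F = refl

ρ⁻¹-ρ : ∀ a → ρ⁻¹ (ρ a) ≡ a
ρ⁻¹-ρ 0F = refl
ρ⁻¹-ρ 1F = refl
ρ⁻¹-ρ 2F = refl

swap01-involutive : ∀ a → swap01 (swap01 a) ≡ a
swap01-involutive 0F = refl
swap01-involutive 1F = refl
swap01-involutive 2F = refl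

ρ⁻¹-swap01-commutator : ∀ a → ρ⁻¹ (swap01 (ρ (swap01 a))) ≡ ρ a
ρ⁻¹-swap01-commutator 0F = refl
ρ⁻¹-swap01-commutator 1F = refl
ρ⁻¹-swap01-commutator 2F = refl

ρ-no-fixpoint : ∀ a → ρ a ≢ a
ρ-no-fixpoint 0F ()
ρ-no-fixpoint 1F ()
ρ-no-fixpoint 2F ()

-- The product action on Fin (m * 3) ≅ Fin m × Fin 3: β on the first
-- factor, α on the second.  It is a monoid homomorphism End m × End 3 →
-- End (m * 3); it is kept opaque so that only these laws are used and
-- unification treats ⊗ m β α as a rigid expression.

opaque
  ⊗ : ∀ m → End m → End 3 → End (m * 3)
  ⊗ m β α x = combine (β (proj₁ (remQuot {m} 3 x))) (α (proj₂ (remQuot {m} 3 x)))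

  ⊗-combine : ∀ {m} (β : End m) (α : End 3) y a → ⊗ m β α (combine y a) ≡ combine (β y) (α a)
  ⊗-combine β α y a = cong (λ (y′ , a′) → combine (β y′) (α a′)) (Fin.remQuot-combine y a)

  ⊗-∘ : ∀ {m} (β β′ : End m) (α α′ : End 3) x → ⊗ m β α (⊗ m β′ α′ x) ≡ ⊗ m (β ∘ β′) (α ∘ α′) x
  ⊗-∘ β β′ α α′ x = ⊗-combine β α _ _

  ⊗-cong : ∀ {m} {β β′ : End m} {α α′ : End 3} → β ≗ β′ → α ≗ α′ → ⊗ m β α ≗ ⊗ m β′ α′
  ⊗-cong β≗β′ α≗α′ x = cong₂ combine (β≗β′ _) (α≗α′ _)

  ⊗-identity : ∀ {m} {β : End m} {α : End 3} → β ≗ id → α ≗ id → ⊗ m β α ≗ id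
  ⊗-identity {m} β≗id α≗id x = trans (⊗-cong β≗id α≗id x) (Fin.combine-remQuot {m} 3 x)

⊗-∘₄ : ∀ {m} (β₁ β₂ β₃ β₄ : End m) (α₁ α₂ α₃ α₄ : End 3) x →
  ⊗ m β₁ α₁ (⊗ m β₂ α₂ (⊗ m β₃ α₃ (⊗ m β₄ α₄ x)))
    ≡ ⊗ m (β₁ ∘ β₂ ∘ β₃ ∘ β₄) (α₁ ∘ α₂ ∘ α₃ ∘ α₄) x
⊗-∘₄ {m} β₁ β₂ β₃ β₄ α₁ α₂ α₃ α₄ x = begin
  ⊗ m β₁ α₁ (⊗ m β₂ α₂ (⊗ m β₃ α₃ (⊗ m β₄ α₄ x)))
    ≡⟨ cong (⊗ m β₁ α₁ ∘ ⊗ m β₂ α₂) (⊗-∘ β₃ β₄ α₃ α₄ x) ⟩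
  ⊗ m β₁ α₁ (⊗ m β₂ α₂ (⊗ m (β₃ ∘ β₄) (α₃ ∘ α₄) x))
    ≡⟨ cong (⊗ m β₁ α₁) (⊗-∘ β₂ (β₃ ∘ β₄) α₂ (α₃ ∘ α₄) x) ⟩
  ⊗ m β₁ α₁ (⊗ m (β₂ ∘ β₃ ∘ β₄) (α₂ ∘ α₃ ∘ α₄) x)
    ≡⟨ ⊗-∘ β₁ (β₂ ∘ β₃ ∘ β₄) α₁ (α₂ ∘ α₃ ∘ α₄) x ⟩
  ⊗ m (β₁ ∘ β₂ ∘ β₃ ∘ β₄) (α₁ ∘ α₂ ∘ α₃ ∘ α₄) x ∎
  where open ≡-Reasoning

-- Fin (size l) is the set of
-- words with l letters from Fin 3 over the base Fin k; letter 0 is the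
-- letter added last, i.e. the Fin 3 factor of Fin (size l * 3).

module Tower (k : ℕ) where
  open ≡-Reasoning

  size : ℕ → ℕ
  size zero    = k
  size (suc l) = size l * 3

  swapAll : ∀ l → End (size l)
  swapAll zero    = id
  swapAll (suc l) = ⊗ (size l) (swapAll l) swap01

  σ σ⁻¹ τ : ∀ {l} → Fin l → End (size l)
  σ {suc l} 0F      = ⊗ (size l) id ρ⁻¹
  σ {suc l} (suc i) = ⊗ (size l) (σ i) id
  σ⁻¹ {suc l} 0F      = ⊗ (size l) id ρ
  σ⁻¹ {suc l} (suc i) = ⊗ (size l) (σ⁻¹ i) id
  τ {suc l} 0F      = swapAll (suc l)
  τ {suc l} (suc j) = ⊗ (size l) (τ j) id

  swapAll-involutive : ∀ l x → swapAll l (swapAll l x) ≡ x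
  swapAll-involutive zero    x = refl
  swapAll-involutive (suc l) x =
    trans (⊗-∘ _ _ _ _ x) (⊗-identity (swapAll-involutive l) swap01-involutive x)

  τ-involutive : ∀ {l} (j : Fin l) x → τ j (τ j x) ≡ x
  τ-involutive {suc l} 0F      x = swapAll-involutive (suc l) x
  τ-involutive {suc l} (suc j) x = trans (⊗-∘ _ _ _ _ x) (⊗-identity (τ-involutive j) (λ _ → refl) x)

  σ-σ⁻¹ : ∀ {l} (i : Fin l) x → σ i (σ⁻¹ i x) ≡ x
  σ-σ⁻¹ {suc l} 0F      x = trans (⊗-∘ _ _ _ _ x) (⊗-identity (λ _ → refl) ρ⁻¹-ρ x)
  σ-σ⁻¹ {suc l} (suc i) x = trans (⊗-∘ _ _ _ _ x) (⊗-identity (σ-σ⁻¹ i) (λ _ → refl) x)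

  σ⁻¹-σ : ∀ {l} (i : Fin l) x → σ⁻¹ i (σ i x) ≡ x
  σ⁻¹-σ {suc l} 0F      x = trans (⊗-∘ _ _ _ _ x) (⊗-identity (λ _ → refl) ρ-ρ⁻¹ x)
  σ⁻¹-σ {suc l} (suc i) x = trans (⊗-∘ _ _ _ _ x) (⊗-identity (σ⁻¹-σ i) (λ _ → refl) x)

  -- For i < j, σ i and τ j act on disjoint sets of letters.
  σ-τ-commute : ∀ {l} (i j : Fin l) → toℕ i < toℕ j → ∀ x → σ i (τ j x) ≡ τ j (σ i x)
  σ-τ-commute {suc l} 0F (suc j) _ x =
    trans (⊗-∘ _ _ _ _ x) (sym (⊗-∘ _ _ _ _ x))
  σ-τ-commute {suc l} (suc i) (suc j) (s≤s i<j) x = begin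
    ⊗ _ (σ i) id (⊗ _ (τ j) id x)  ≡⟨ ⊗-∘ _ _ _ _ x ⟩
    ⊗ _ (σ i ∘ τ j) id x           ≡⟨ ⊗-cong (σ-τ-commute i j i<j) (λ _ → refl) x ⟩
    ⊗ _ (τ j ∘ σ i) id x           ≡⟨ sym (⊗-∘ _ _ _ _ x) ⟩
    ⊗ _ (τ j) id (⊗ _ (σ i) id x)  ∎

  -- For j ≤ i, [σ i, τ j] = σ i⁻¹: letter i sees [ρ⁻¹, (0 1)] = ρ and
  -- every other letter sees id or (0 1)² = id.
  σ-τ-commutator : ∀ {l} (i j : Fin l) → toℕ j ≤ toℕ i → ∀ x → σ i (τ j (σ⁻¹ i (τ j x))) ≡ σ⁻¹ i x
  σ-τ-commutator {suc l} 0F 0F _ x =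
    trans (⊗-∘₄ _ _ _ _ _ _ _ _ x) (⊗-cong (swapAll-involutive l) ρ⁻¹-swap01-commutator x)
  σ-τ-commutator {suc (suc l)} (suc i) 0F _ x =
    trans (⊗-∘₄ _ _ _ _ _ _ _ _ x) (⊗-cong (σ-τ-commutator i 0F z≤n) swap01-involutive x)
  σ-τ-commutator {suc l} (suc i) (suc j) (s≤s j≤i) x =
    trans (⊗-∘₄ _ _ _ _ _ _ _ _ x) (⊗-cong (σ-τ-commutator i j j≤i) (λ _ → refl) x)

  -- The chart of letter i: a word of length l+1 is its i-th letter together
  -- with the remaining word of length l.  chart and coords are inverse.
  chart : ∀ {l} → Fin (suc l) → Fin 3 × Fin (size l) → Fin (size (suc l))
  chart 0F (a , w) = combine w a
  chart {suc l} (suc i) (a , w) = combine (chart i (a , proj₁ (remQuot {size l} 3 w))) (proj₂ (remQuot {size l} 3 w))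

  coords : ∀ {l} → Fin (suc l) → Fin (size (suc l)) → Fin 3 × Fin (size l)
  coords 0F x = swap (remQuot 3 x)
  coords {suc l} (suc i) x =
    map₂ (λ w → combine w (proj₂ (remQuot {size (suc l)} 3 x))) (coords i (proj₁ (remQuot {size (suc l)} 3 x)))

  coords-chart : ∀ {l} (i : Fin (suc l)) u → coords i (chart i u) ≡ u
  coords-chart 0F (a , w) = cong swap (Fin.remQuot-combine w a)
  coords-chart {suc l} (suc i) (a , w) = begin
    coords (suc i) (chart (suc i) (a , w))
      ≡⟨ cong (λ (y , b) → map₂ (λ v → combine v b) (coords i y)) (Fin.remQuot-combine _ _) ⟩
    map₂ (λ v → combine v b) (coords i (chart i (a , q)))
      ≡⟨ cong (map₂ (λ v → combine v b)) (coords-chart i (a , q)) ⟩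
    (a , combine q b)
      ≡⟨ cong (a ,_) (Fin.combine-remQuot {size l} 3 w) ⟩
    (a , w) ∎
    where
    q : Fin (size l)
    q = proj₁ (remQuot {size l} 3 w)
    b : Fin 3
    b = proj₂ (remQuot {size l} 3 w)

  chart-coords : ∀ {l} (i : Fin (suc l)) x → chart i (coords i x) ≡ x
  chart-coords {l} 0F x = Fin.combine-remQuot {size l} 3 x
  chart-coords {suc l} (suc i) x = begin
    chart (suc i) (a , combine w b)
      ≡⟨ cong (λ (v , c) → combine (chart i (a , v)) c) (Fin.remQuot-combine w b) ⟩
    combine (chart i (coords i y)) b
      ≡⟨ cong (λ z → combine z b) (chart-coords i y) ⟩
    combine y b
      ≡⟨ Fin.combine-remQuot {size (suc l)} 3 x ⟩
    x ∎
    where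
    y : Fin (size (suc l))
    y = proj₁ (remQuot {size (suc l)} 3 x)
    b a : Fin 3
    b = proj₂ (remQuot {size (suc l)} 3 x)
    a = proj₁ (coords i y)
    w : Fin (size l)
    w = proj₂ (coords i y)

  σ⁻¹-chart : ∀ {l} (i : Fin (suc l)) a w → σ⁻¹ i (chart i (a , w)) ≡ chart i (ρ a , w)
  σ⁻¹-chart 0F a w = ⊗-combine id ρ w a
  σ⁻¹-chart {suc l} (suc i) a w =
    trans (⊗-combine (σ⁻¹ i) id _ _) (cong (λ z → combine z _) (σ⁻¹-chart i a _))

data Padded (N r : ℕ) : Fin (N + r) → Set where
  old : (y : Fin N) → Padded N r (y ↑ˡ r)
  new : (z : Fin r) → Padded N r (N ↑ʳ z)

padded : ∀ N r x → Padded N r x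
padded N r x with splitAt N x in eq
... | inj₁ y = subst (Padded N r) (Fin.splitAt⁻¹-↑ˡ eq) (old y)
... | inj₂ z = subst (Padded N r) (Fin.splitAt⁻¹-↑ʳ eq) (new z)

pad : ∀ {N} r → End N → End (N + r)
pad {N} r f x = [ (λ y → f y ↑ˡ r) , N ↑ʳ_ ]′ (splitAt N x)

pad-old : ∀ {N} r (f : End N) y → pad r f (y ↑ˡ r) ≡ f y ↑ˡ r
pad-old {N} r f y = cong [ (λ y → f y ↑ˡ r) , N ↑ʳ_ ]′ (Fin.splitAt-↑ˡ N y r)

pad-new : ∀ {N} r (f : End N) z → pad r f (N ↑ʳ z) ≡ N ↑ʳ z
pad-new {N} r f z = cong [ (λ y → f y ↑ˡ r) , N ↑ʳ_ ]′ (Fin.splitAt-↑ʳ N r z)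

pad-∘ : ∀ {N} r (f g : End N) x → pad r f (pad r g x) ≡ pad r (f ∘ g) x
pad-∘ {N} r f g x with padded N r x
... | old y = begin
  pad r f (pad r g (y ↑ˡ r))  ≡⟨ cong (pad r f) (pad-old r g y) ⟩
  pad r f (g y ↑ˡ r)          ≡⟨ pad-old r f (g y) ⟩
  f (g y) ↑ˡ r                ≡⟨ sym (pad-old r (f ∘ g) y) ⟩
  pad r (f ∘ g) (y ↑ˡ r)      ∎
  where open ≡-Reasoning
... | new z = begin
  pad r f (pad r g (N ↑ʳ z))  ≡⟨ cong (pad r f) (pad-new r g z) ⟩
  pad r f (N ↑ʳ z)            ≡⟨ pad-new r f z ⟩
  N ↑ʳ z                      ≡⟨ sym (pad-new r (f ∘ g) z) ⟩
  pad r (f ∘ g) (N ↑ʳ z)      ∎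
  where open ≡-Reasoning

pad-cong : ∀ {N} r {f g : End N} → f ≗ g → pad r f ≗ pad r g
pad-cong {N} r f≗g x with padded N r x
... | old y = trans (pad-old r _ y) (trans (cong (_↑ˡ r) (f≗g y)) (sym (pad-old r _ y)))
... | new z = trans (pad-new r _ z) (sym (pad-new r _ z))

pad-identity : ∀ {N} r {f : End N} → f ≗ id → pad r f ≗ id
pad-identity {N} r f≗id x with padded N r x
... | old y = trans (pad-old r _ y) (cong (_↑ˡ r) (f≗id y))
... | new z = pad-new r _ z

pad-∘₄ : ∀ {N} r (f₁ f₂ f₃ f₄ : End N) x →
  pad r f₁ (pad r f₂ (pad r f₃ (pad r f₄ x))) ≡ pad r (f₁ ∘ f₂ ∘ f₃ ∘ f₄) x
pad-∘₄ r f₁ f₂ f₃ f₄ x = begin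
  pad r f₁ (pad r f₂ (pad r f₃ (pad r f₄ x)))  ≡⟨ cong (pad r f₁ ∘ pad r f₂) (pad-∘ r f₃ f₄ x) ⟩
  pad r f₁ (pad r f₂ (pad r (f₃ ∘ f₄) x))      ≡⟨ cong (pad r f₁) (pad-∘ r f₂ (f₃ ∘ f₄) x) ⟩
  pad r f₁ (pad r (f₂ ∘ f₃ ∘ f₄) x)            ≡⟨ pad-∘ r f₁ (f₂ ∘ f₃ ∘ f₄) x ⟩
  pad r (f₁ ∘ f₂ ∘ f₃ ∘ f₄) x                  ∎
  where open ≡-Reasoning

padPerm : ∀ {N} r (f f⁻¹ : End N) → (∀ x → f (f⁻¹ x) ≡ x) → (∀ x → f⁻¹ (f x) ≡ x) → Perm (N + r)
padPerm r f f⁻¹ f∘f⁻¹ f⁻¹∘f =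
  permutation (pad r f) (pad r f⁻¹)
    (λ x → trans (pad-∘ r f f⁻¹ x) (pad-identity r f∘f⁻¹ x))
    (λ x → trans (pad-∘ r f⁻¹ f x) (pad-identity r f⁻¹∘f x))

module _ {n M : ℕ} (p : Fin 3 → Fin M → Fin n) where

  triple : Fin M → Fin n × Fin n × Fin n
  triple w = p 0F w , p 1F w , p 2F w

  points-triples : ∀ ws → points (map triple ws) ≡ cartesianProductWith (flip p) ws (allFin 3)
  points-triples []       = refl
  points-triples (w ∷ ws) = cong (λ ps → p 0F w ∷ p 1F w ∷ p 2F w ∷ ps) (points-triples ws)

  prodOf3Cycles : (f : End n) →
    (∀ {a w b v} → p a w ≡ p b v → a ≡ b × w ≡ v) →
    (∀ a w → f (p a w) ≡ p (ρ a) w) →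
    (∀ x → (∃₂ λ a w → p a w ≡ x) ⊎ f x ≡ x) →
    IsProdOfDisjoint3Cycles M f
  prodOf3Cycles f p-injective f-on-p support =
    cycles , lengthCycles , distinct , isCycle , fixedOutside
    where
    cycles : List (Fin n × Fin n × Fin n)
    cycles = map triple (allFin M)

    lengthCycles : length cycles ≡ M
    lengthCycles = trans (List.length-map triple (allFin M)) (List.length-tabulate id)

    distinct : Unique (points cycles)
    distinct = subst Unique (sym (points-triples (allFin M)))
      (Unique.cartesianProductWith⁺ (flip p) (swap ∘ p-injective) (Unique.allFin⁺ M) (Unique.allFin⁺ 3))

    isCycle : ∀ {x y z} → (x , y , z) ∈ cycles → (f x ≡ y) × (f y ≡ z) × (f z ≡ x)
    isCycle x∈ with ∈-map⁻ triple x∈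
    ... | w , _ , refl = f-on-p 0F w , f-on-p 1F w , f-on-p 2F w

    fixedOutside : ∀ x → x ∉ points cycles → f x ≡ x
    fixedOutside x x∉ with support x
    ... | inj₂ fixed = fixed
    ... | inj₁ (a , w , refl) = ⊥-elim (x∉ (subst (p a w ∈_) (sym (points-triples (allFin M)))
                                  (∈-cartesianProductWith⁺ (flip p) (∈-allFin w) (∈-allFin a))))

-- Listing Fin (N + r) as the old
-- points followed by the new ones, a map that moves every old point and
-- fixes every new one differs from the identity in exactly N places.

tabulate-+ : ∀ {A : Set} N r (g : Fin (N + r) → A) →
  tabulate g ≡ tabulate (g ∘ (_↑ˡ r)) ++ tabulate (g ∘ (N ↑ʳ_))
tabulate-+ zero    r g = refl
tabulate-+ (suc N) r g = cong (g 0F ∷_) (tabulate-+ N r (g ∘ suc))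

hammingCount-padded : ∀ {N r} (f : End (N + r)) →
  (∀ y → f (y ↑ˡ r) ≢ y ↑ˡ r) → (∀ z → f (N ↑ʳ z) ≡ N ↑ʳ z) → hammingCount f e ≡ N
hammingCount-padded {N} {r} f moves fixes = begin
  length (filter moved? (tabulate id))                  ≡⟨ cong (length ∘ filter moved?) (tabulate-+ N r id) ⟩
  length (filter moved? (olds ++ news))                 ≡⟨ cong length (List.filter-++ moved? olds news) ⟩
  length (filter moved? olds ++ filter moved? news)     ≡⟨ cong₂ (λ us vs → length (us ++ vs))
                                                             (List.filter-all moved? (All.tabulate⁺ moves))
                                                             (List.filter-none moved? (All.tabulate⁺ (λ z → _$ fixes z))) ⟩
  length (olds ++ [])                                   ≡⟨ cong length (List.++-identityʳ olds) ⟩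
  length olds                                           ≡⟨ List.length-tabulate (_↑ˡ r) ⟩
  N                                                     ∎
  where
  open ≡-Reasoning
  moved? : (x : Fin (N + r)) → Dec (f x ≢ e x)
  moved? x = ¬? (f x ≟ e x)
  olds news : List (Fin (N + r))
  olds = tabulate (_↑ˡ r)
  news = tabulate (N ↑ʳ_)

frac-mono : ∀ a b c d → 0 < b → 0 < d → a * d ≤ c * b → frac a b ≤ᵘ frac c d
frac-mono a (suc b) c (suc d) _ _ ad≤cb =
  *≤* (subst₂ ℤ._≤_ (pos-* a (suc d)) (pos-* c (suc b)) (ℤ.+≤+ ad≤cb))

-- k/(k+1) ≤ A/(A+r) for A = 3^l·k and r < 3^l, since k·r ≤ A.
k/[k+1]≤A/[A+r] : ∀ k l r → 1 ≤ k → r < 3 ^ l → frac k (k + 1) ≤ᵘ frac (3 ^ l * k) (3 ^ l * k + r)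
k/[k+1]≤A/[A+r] k l r 1≤k r<3^l =
  frac-mono k (k + 1) A (A + r) (ℕ.m≤n+m 1 k) (ℕ.≤-trans 1≤A (ℕ.m≤m+n A r)) cross
  where
  open ℕ.≤-Reasoning
  A : ℕ
  A = 3 ^ l * k
  1≤A : 1 ≤ A
  1≤A = ℕ.*-mono-≤ (ℕ.m^n>0 3 l) 1≤k
  kr≤A : k * r ≤ A
  kr≤A = ℕ.≤-trans (ℕ.*-monoʳ-≤ k (ℕ.<⇒≤ r<3^l)) (ℕ.≤-reflexive (ℕ.*-comm k (3 ^ l)))
  cross : k * (A + r) ≤ A * (k + 1)
  cross = begin
    k * (A + r)    ≡⟨ ℕ.*-distribˡ-+ k A r ⟩
    k * A + k * r  ≤⟨ ℕ.+-mono-≤ (ℕ.≤-reflexive (ℕ.*-comm k A)) kr≤A ⟩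
    A * k + A      ≡⟨ cong (A * k +_) (sym (ℕ.*-identityʳ A)) ⟩
    A * k + A * 1  ≡⟨ sym (ℕ.*-distribˡ-+ A k 1) ⟩
    A * (k + 1)    ∎

1/2≤k/[k+1] : ∀ k → 1 ≤ k → frac 1 2 ≤ᵘ frac k (k + 1)
1/2≤k/[k+1] k 1≤k = frac-mono 1 2 k (k + 1) (s≤s z≤n) (ℕ.m≤n+m 1 k) cross
  where
  open ℕ.≤-Reasoning
  cross : 1 * (k + 1) ≤ k * 2
  cross = begin
    1 * (k + 1)  ≡⟨ ℕ.*-identityˡ (k + 1) ⟩
    k + 1        ≤⟨ ℕ.+-monoʳ-≤ k 1≤k ⟩
    k + k        ≡⟨ cong (k +_) (sym (ℕ.*-identityʳ k)) ⟩
    k + k * 1    ≡⟨ sym (ℕ.*-suc k 1) ⟩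
    k * 2        ∎

module Construction (k l r : ℕ) where
  open Tower k
  open ≡-Reasoning

  Σs Ts : Fin (suc l) → Perm (size (suc l) + r)
  Σs i = padPerm r (σ i) (σ⁻¹ i) (σ-σ⁻¹ i) (σ⁻¹-σ i)
  Ts j = padPerm r (τ j) (τ j) (τ-involutive j) (τ-involutive j)

  Σs-Ts-commute : ∀ i j → toℕ i < toℕ j → Commute (Σs i) (Ts j)
  Σs-Ts-commute i j i<j x =
    trans (pad-∘ r (σ i) (τ j) x) (trans (pad-cong r (σ-τ-commute i j i<j) x) (sym (pad-∘ r (τ j) (σ i) x)))

  module _ (i j : Fin (suc l)) (j≤i : toℕ j ≤ toℕ i) where

    commutator≗σ⁻¹ : commutator (Σs i) (Ts j) ≗ pad r (σ⁻¹ i)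
    commutator≗σ⁻¹ x = trans (pad-∘₄ r (σ i) (τ j) (σ⁻¹ i) (τ j) x) (pad-cong r (σ-τ-commutator i j j≤i) x)

    p : Fin 3 → Fin (size l) → Fin (size (suc l) + r)
    p a w = chart i (a , w) ↑ˡ r

    p-injective : ∀ {a w b v} → p a w ≡ p b v → a ≡ b × w ≡ v
    p-injective {a} {w} {b} {v} eq = ,-injectiveˡ same , ,-injectiveʳ same
      where
      same : (a , w) ≡ (b , v)
      same = trans (sym (coords-chart i (a , w)))
               (trans (cong (coords i) (Fin.↑ˡ-injective r _ _ eq)) (coords-chart i (b , v)))

    commutator-on-p : ∀ a w → commutator (Σs i) (Ts j) (p a w) ≡ p (ρ a) w
    commutator-on-p a w = begin
      commutator (Σs i) (Ts j) (p a w)  ≡⟨ commutator≗σ⁻¹ (p a w) ⟩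
      pad r (σ⁻¹ i) (p a w)             ≡⟨ pad-old r (σ⁻¹ i) _ ⟩
      σ⁻¹ i (chart i (a , w)) ↑ˡ r       ≡⟨ cong (_↑ˡ r) (σ⁻¹-chart i a w) ⟩
      p (ρ a) w                         ∎

    commutator-fixes-new : ∀ z → commutator (Σs i) (Ts j) (size (suc l) ↑ʳ z) ≡ size (suc l) ↑ʳ z
    commutator-fixes-new z = trans (commutator≗σ⁻¹ _) (pad-new r (σ⁻¹ i) z)

    commutator-support : ∀ x → (∃₂ λ a w → p a w ≡ x) ⊎ commutator (Σs i) (Ts j) x ≡ x
    commutator-support x with padded (size (suc l)) r x
    ... | old y = inj₁ (proj₁ (coords i y) , proj₂ (coords i y) , cong (_↑ˡ r) (chart-coords i y))
    ... | new z = inj₂ (commutator-fixes-new z)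

    -- Every old point lies on a 3-cycle, because ρ has no fixed point.
    commutator-moves-old : ∀ y → commutator (Σs i) (Ts j) (y ↑ˡ r) ≢ y ↑ˡ r
    commutator-moves-old y fixed = ρ-no-fixpoint a (proj₁ (p-injective (begin
      p (ρ a) w                               ≡⟨ sym (commutator-on-p a w) ⟩
      commutator (Σs i) (Ts j) (p a w)        ≡⟨ cong (commutator (Σs i) (Ts j) ∘ (_↑ˡ r)) (chart-coords i y) ⟩
      commutator (Σs i) (Ts j) (y ↑ˡ r)       ≡⟨ fixed ⟩
      y ↑ˡ r                                  ≡⟨ cong (_↑ˡ r) (sym (chart-coords i y)) ⟩
      p a w                                   ∎)))
      where
      a : Fin 3
      a = proj₁ (coords i y)
      w : Fin (size l)
      w = proj₂ (coords i y)

    commutator-cycles : IsProdOfDisjoint3Cycles (size l) (commutator (Σs i) (Ts j))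
    commutator-cycles =
      prodOf3Cycles p (commutator (Σs i) (Ts j)) p-injective commutator-on-p commutator-support

    commutator-distance : d (commutator (Σs i) (Ts j)) e ≃ frac (size (suc l)) (size (suc l) + r)
    commutator-distance = ≃-reflexive (cong (λ h → frac h (size (suc l) + r))
      (hammingCount-padded (commutator (Σs i) (Ts j)) commutator-moves-old commutator-fixes-new))

size≡3^l*k : ∀ k l → Tower.size k l ≡ 3 ^ l * k
size≡3^l*k k zero    = sym (ℕ.+-identityʳ k)
size≡3^l*k k (suc l) = begin
  Tower.size k l * 3  ≡⟨ cong (_* 3) (size≡3^l*k k l) ⟩
  3 ^ l * k * 3       ≡⟨ ℕ.*-comm (3 ^ l * k) 3 ⟩
  3 * (3 ^ l * k)     ≡⟨ sym (ℕ.*-assoc 3 (3 ^ l) k) ⟩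
  3 ^ suc l * k       ∎
  where open ≡-Reasoning

construction : ∀ k l r {N M} → Tower.size k (suc l) ≡ N → Tower.size k l ≡ M →
  ∃₂ λ (Σs Ts : Fin (suc l) → Perm (N + r)) → ∀ i j →
    (toℕ i < toℕ j → Commute (Σs i) (Ts j))
    × (toℕ j ≤ toℕ i → IsProdOfDisjoint3Cycles M (commutator (Σs i) (Ts j))
                      × d (commutator (Σs i) (Ts j)) e ≃ frac N (N + r))
construction k l r refl refl =
  Σs , Ts , λ i j → Σs-Ts-commute i j , λ j≤i → commutator-cycles i j j≤i , commutator-distance i j j≤i
  where open Construction k l r

lemma2p4 : ∀ (n k l r : ℕ) → 1 ≤ k → 1 ≤ l → n ≡ 3 ^ l * k + r → r < 3 ^ l →
    ∃₂ λ (Σs Ts : Fin l → Perm n) → ∀ (i j : Fin l) →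
      (toℕ i < toℕ j → Commute (Σs i) (Ts j))
      × (toℕ j ≤ toℕ i →
          IsProdOfDisjoint3Cycles (3 ^ (l ∸ 1) * k) (commutator (Σs i) (Ts j))
          × d (commutator (Σs i) (Ts j)) e ≃ frac (3 ^ l * k) (3 ^ l * k + r)
          × frac k (k + 1) ≤ᵘ frac (3 ^ l * k) (3 ^ l * k + r)
          × frac 1 2 ≤ᵘ frac k (k + 1))
lemma2p4 n k zero    r _   ()  _    _
lemma2p4 n k (suc l) r 1≤k _   refl r<3^l
  with Σs , Ts , props ← construction k l r (size≡3^l*k k (suc l)) (size≡3^l*k k l) =
  Σs , Ts , λ i j → proj₁ (props i j) , λ j≤i →
    proj₁ (proj₂ (props i j) j≤i) , proj₂ (proj₂ (props i j) j≤i) ,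
    k/[k+1]≤A/[A+r] k (suc l) r 1≤k r<3^l , 1/2≤k/[k+1] k 1≤k
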